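{- Let $\mathbf{x}\in\{0,1\}^m$. If $P_I(\mathbf{x})=0$ for all $1\le I\le 10$, then $P_{12}(\mathbf{x})>-2n_{\mathcal{N}}$.
   Context: $\mathcal{N}$ is a rooted binary phylogenetic network on a finite set $X$ with vertices $v_0,\dots,v_{n_{\mathcal{N}}-1}$. That is, $\mathcal{N}$ is an acyclic digraph without parallel edges with a unique root (in-degree 0, out-degree 2, reaching all vertices), leaves of in-degree 1 forming $X$, and other vertices of in/out-degree $(1,2)$ or $(2,1)$. $\mathcal{T}$ is a rooted binary phylogenetic $X$-tree (no in-degree-2 vertices) with vertices $u_0,\dots,u_{n_{\mathcal{T}}-1}$, $u_0$ its root. Assume $n_{\mathcal{N}}\ge n_{\mathcal{T}}$, and let $s=1+\lfloor\log_2(n_{\mathcal{N}}-n_{\mathcal{T}})\rfloor$ if $n_{\mathcal{N}}>n_{\mathcal{T}}$ and $s=0$ otherwise. Tree vertices have out-degree 2, with children $v_{j_1},v_{j_2}$. Reticulation vertices have in-degree 2, with parents $v_{j^1},v_{j^2}$. $f(u_i,u_l)=1$ iff $(u_i,u_l)\in E(\mathcal{T})$, and $g(v_j,v_k)=1$ iff $(v_j,v_k)\in E(\mathcal{N})$. For a leaf $u_i$ of $\mathcal{T}$, $\ell(i)$ is the index of the equally labeled leaf of $\mathcal{N}$. The binary variables (forming $\mathbf{x}\in\{0,1\}^m$) are: - $x_{i,j}$ ($0\le i\le n_{\mathcal{T}}$, $0\le j<n_{\mathcal{N}}$); - $y_{i,r}$ ($1\le i<n_{\mathcal{T}}$, $0\le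 r<s$); - $z_{i,j}$ ($i<n_{\mathcal{T}}$, $v_j$ tree or reticulation); - $\hat z_{i,2j},\hat z_{i,2j+1}$ ($u_i$ non-leaf, $v_j$ tree). With $i,l\in\{0,\dots,n_{\mathcal{T}}-1\}$ and $j,k\in\{0,\dots,n_{\mathcal{N}}-1\}$: - $P_1=(1-\sum_jx_{0,j})^2+\sum_{i=1}^{n_{\mathcal{T}}-1}(1-\sum_jx_{i,j}+\sum_{r=0}^{s-1}2^ry_{i,r})^2$; - $P_2=\sum_j(\sum_{i=0}^{n_{\mathcal{T}}}x_{i,j}-1)^2$; - $P_3=\sum_i\sum_{\text{tree }v_j}(x_{i,j_1}x_{i,j_2}-2x_{i,j_1}z_{i,j}-2x_{i,j_2}z_{i,j}+3z_{i,j})$; - $P_4=\sum_i\sum_{\text{tree }v_j}x_{i,j}z_{i,j}$; - $P_5=\sum_i\sum_{\text{ret. }v_j}(x_{i,j^1}x_{i,j^2}-2x_{i,j^1}z_{i,j}-2x_{i,j^2}z_{i,j}+3z_{i,j})$; - $P_6=\sum_i\sum_{\text{ret. }v_j}x_{i,j}z_{i,j}$; - $P_7=\sum_i\sum_{l\ne i}f(u_i,u_l)\sum_{\text{tree }v_j}x_{i,j}z_{l,j}$; - $P_8=\sum_{u_i\text{ non-leaf}}\sum_{\text{tree }v_j}(x_{i,j}x_{i,j_1}-2x_{i,j}\hat z_{i,2j}-2x_{i,j_1}\hat z_{i,2j}+3\hat z_{i,2j}+x_{i,j}x_{i,j_2}-2x_{i,j}\hat z_{i,2j+1}-2x_{i,j_2}\hat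 z_{i,2j+1}+3\hat z_{i,2j+1})$; - $P_9=\sum_i\sum_{l\ne i}f(u_i,u_l)\sum_{\text{tree }v_j}(\hat z_{i,2j}x_{l,j_2}+\hat z_{i,2j+1}x_{l,j_1})$; - $P_{10}=\sum_{u_i\text{ leaf}}(1-x_{i,\ell(i)})^2$; - $P_{12}=\sum_i\sum_{l\ne i}f(u_i,u_l)(1-\sum_j\sum_{k\ne j}g(v_j,v_k)x_{i,j}x_{l,k})$. -}

module Defs where

open import Data.Bool using (Bool; true; false; if_then_else_; not)
open import Data.Nat as ℕ using (ℕ; zero; suc; _≤_; _<ᵇ_; _≡ᵇ_; _∸_; _^_)
open import Data.Nat.Logarithm using (⌊log₂_⌋)
open import Data.Fin using (Fin; zero; suc; inject₁; fromℕ; toℕ; _≟_)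
open import Data.Integer using (ℤ; +_; _+_; _-_; _*_)
open import Data.Product using (_×_; ∃)
open import Data.Sum using (_⊎_)
open import Relation.Binary.PropositionalEquality using (_≡_; _≢_)
open import Relation.Nullary using (¬_)
open import Relation.Nullary.Decidable using (⌊_⌋)
open import Relation.Binary.Construct.Closure.ReflexiveTransitive using (Star)
open import Relation.Binary.Construct.Closure.Transitive using (TransClosure)
open import Function.Definitions using (Injective)

∑ : (n : ℕ) → (Fin n → ℤ) → ℤ
∑ zero    f = + 0
∑ (suc n) f = f zero + ∑ n (λ i → f (suc i))

count : (n : ℕ) → (Fin n → Bool) → ℕ
count zero    p = 0
count (suc n) p = (if p zero then 1 else 0) ℕ.+ count n (λ i → p (suc i))

B : Bool → ℤ
B true  = + 1
B false = + 0

sq : ℤ → ℤ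
sq a = a * a

[_]_ : Bool → ℤ → ℤ
[ b ] a = if b then a else + 0

infix 5 [_]_

module _ {n : ℕ} (g : Fin n → Fin n → Bool) where
  Edge : Fin n → Fin n → Set
  Edge a b = g a b ≡ true

  indeg : Fin n → ℕ
  indeg v = count n (λ u → g u v)

  outdeg : Fin n → ℕ
  outdeg v = count n (λ w → g v w)

-- Rooted binary phylogenetic network on the label set X = Fin k,
-- with vertex set Fin n (vertex v_j is j).  Parallel edges are
-- impossible since edges are given by an adjacency function.
record Network (k n : ℕ) : Set where
  field
    g            : Fin n → Fin n → Bool
    acyclic      : ∀ v → ¬ TransClosure (Edge g) v v
    root         : Fin n
    root-indeg   : indeg g root ≡ 0
    root-outdeg  : outdeg g root ≡ 2
    root-reaches : ∀ v → Star (Edge g) root v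
    root-unique  : ∀ v → indeg g v ≡ 0 → v ≡ root
    degrees      : ∀ v → v ≡ root
                         ⊎ (indeg g v ≡ 1 × outdeg g v ≡ 0)
                         ⊎ (indeg g v ≡ 1 × outdeg g v ≡ 2)
                         ⊎ (indeg g v ≡ 2 × outdeg g v ≡ 1)
    label        : Fin k → Fin n
    label-inj    : Injective _≡_ _≡_ label
    label-leaf   : ∀ a → outdeg g (label a) ≡ 0
    leaf-label   : ∀ v → outdeg g v ≡ 0 → ∃ λ a → label a ≡ v
    child₁ child₂ : Fin n → Fin n
    children     : ∀ v → outdeg g v ≡ 2 →
                   Edge g v (child₁ v) × Edge g v (child₂ v) × child₁ v ≢ child₂ v
    parent₁ parent₂ : Fin n → Fin n
    parents      : ∀ v → indeg g v ≡ 2 →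
                   Edge g (parent₁ v) v × Edge g (parent₂ v) v × parent₁ v ≢ parent₂ v

  isTreeV : Fin n → Bool
  isTreeV v = outdeg g v ≡ᵇ 2

  isRet : Fin n → Bool
  isRet v = indeg g v ≡ᵇ 2

  isLeaf : Fin n → Bool
  isLeaf v = outdeg g v ≡ᵇ 0

record PhyloTree (k n : ℕ) : Set where
  field
    net       : Network k n
  open Network net public
  field
    no-ret    : ∀ v → indeg g v ≢ 2
    root-zero : toℕ root ≡ 0

slack : ℕ → ℕ → ℕ
slack nN nT = if nT <ᵇ nN then suc ⌊log₂ (nN ∸ nT) ⌋ else 0

-- Index sets are taken as full
-- rectangles; the components not listed in the paper
-- (y_{0,r}, z_{i,j} for leaves v_j, ẑ for leaf u_i or non-tree v_j)
-- occur in no penalty term.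
record Vars (nN nT : ℕ) : Set where
  field
    x  : Fin (suc nT) → Fin nN → Bool
    y  : Fin nT → Fin (slack nN nT) → Bool
    z  : Fin nT → Fin nN → Bool
    ẑ₀ : Fin nT → Fin nN → Bool                -- ẑ_{i,2j}
    ẑ₁ : Fin nT → Fin nN → Bool                -- ẑ_{i,2j+1}

module Penalties {k nN nT : ℕ} (N : Network k nN) (T : PhyloTree k nT)
                 (ℓ : Fin nT → Fin nN) (V : Vars nN nT) where
  open Vars V
  private
    module N = Network N
    module T = PhyloTree T
    s = slack nN nT
    X : Fin nT → Fin nN → ℤ
    X i j = B (x (inject₁ i) j)
    Z : Fin nT → Fin nN → ℤ
    Z i j = B (z i j)
    f : Fin nT → Fin nT → ℤ
    f i l = B (T.g i l)
    ne : ∀ {m} → Fin m → Fin m → Bool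
    ne i l = not ⌊ i ≟ l ⌋
    j₁ j₂ j¹ j² : Fin nN → Fin nN
    j₁ = N.child₁
    j₂ = N.child₂
    j¹ = N.parent₁
    j² = N.parent₂

  P₁ : ℤ
  P₁ = ∑ nT λ i → sq (+ 1 - ∑ nN (X i)
          + ([ not (toℕ i ≡ᵇ 0) ] ∑ s (λ r → + (2 ^ toℕ r) * B (y i r))))

  P₂ : ℤ
  P₂ = ∑ nN λ j → sq (∑ (suc nT) (λ i → B (x i j)) - + 1)

  P₃ : ℤ
  P₃ = ∑ nT λ i → ∑ nN λ j → [ N.isTreeV j ]
         (X i (j₁ j) * X i (j₂ j) - + 2 * X i (j₁ j) * Z i j
          - + 2 * X i (j₂ j) * Z i j + + 3 * Z i j)

  P₄ : ℤ
  P₄ = ∑ nT λ i → ∑ nN λ j → [ N.isTreeV j ] (X i j * Z i j)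

  P₅ : ℤ
  P₅ = ∑ nT λ i → ∑ nN λ j → [ N.isRet j ]
         (X i (j¹ j) * X i (j² j) - + 2 * X i (j¹ j) * Z i j
          - + 2 * X i (j² j) * Z i j + + 3 * Z i j)

  P₆ : ℤ
  P₆ = ∑ nT λ i → ∑ nN λ j → [ N.isRet j ] (X i j * Z i j)

  P₇ : ℤ
  P₇ = ∑ nT λ i → ∑ nT λ l → [ ne i l ]
         (f i l * ∑ nN λ j → [ N.isTreeV j ] (X i j * Z l j))

  P₈ : ℤ
  P₈ = ∑ nT λ i → [ not (T.isLeaf i) ] ∑ nN λ j → [ N.isTreeV j ]
         (X i j * X i (j₁ j) - + 2 * X i j * B (ẑ₀ i j)
          - + 2 * X i (j₁ j) * B (ẑ₀ i j) + + 3 * B (ẑ₀ i j)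
          + X i j * X i (j₂ j) - + 2 * X i j * B (ẑ₁ i j)
          - + 2 * X i (j₂ j) * B (ẑ₁ i j) + + 3 * B (ẑ₁ i j))

  P₉ : ℤ
  P₉ = ∑ nT λ i → ∑ nT λ l → [ ne i l ]
         (f i l * ∑ nN λ j → [ N.isTreeV j ]
            (B (ẑ₀ i j) * X l (j₂ j) + B (ẑ₁ i j) * X l (j₁ j)))

  P₁₀ : ℤ
  P₁₀ = ∑ nT λ i → [ T.isLeaf i ] sq (+ 1 - X i (ℓ i))

  P₁₂ : ℤ
  P₁₂ = ∑ nT λ i → ∑ nT λ l → [ ne i l ]
          (f i l * (+ 1 - ∑ nN λ j → ∑ nN λ k′ → [ ne j k′ ]
                      (B (N.g j k′) * X i j * X l k′)))

open Penalties public

-- It says that every network vertex v_j carries exactly one of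
-- x_{0,j}, …, x_{n_T,j}, so at most one tree vertex u_i with i < n_T is placed on v_j.
-- The negative part of P₁₂ is, up to the guards, the number of pairs (u_i, u_l) whose
-- images span an edge of 𝒩; with the placement injective this is at most the number of
-- edges of 𝒩, which is the sum of the in-degrees and hence below 2 n_𝒩 because every
-- in-degree is at most 2 and the root's is 0.
module Submission where

open import Defs
open import Data.Nat using (ℕ; _≤_; _*_)
open import Data.Fin using (Fin)
open import Data.Integer using (+_; -_; _<_)
open import Relation.Binary.PropositionalEquality using (_≡_)

open import Data.Bool using (Bool; true; false; not)
open import Data.Fin using (zero; suc; inject₁; _≟_)
open import Data.Integer using (ℤ; _+_; _-_; +≤+)
import Data.Integer as ℤ
import Data.Integer.Properties as ℤ
open import Data.Nat using (zero; suc; z≤n; s≤s)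
import Data.Nat.Properties as ℕ
open import Data.Product using (_,_)
open import Data.Sum using (inj₁; inj₂)
open import Data.Vec.Functional using (Vector)
open import Function using (_∘_)
open import Relation.Binary.PropositionalEquality using (refl; sym; trans; cong; cong₂; subst; module ≡-Reasoning)
open import Relation.Nullary.Decidable using (⌊_⌋)
open import Algebra.Properties.Semiring.Sum ℤ.+-*-semiring using (sum; sum-cong-≗; ∑-comm)

∑≡sum : ∀ n (f : Vector ℤ n) → ∑ n f ≡ sum f
∑≡sum zero    f = refl
∑≡sum (suc n) f = cong (_+_ (f zero)) (∑≡sum n (f ∘ suc))

∑-cong : ∀ n {f g : Fin n → ℤ} → (∀ i → f i ≡ g i) → ∑ n f ≡ ∑ n g
∑-cong zero    f≗g = refl
∑-cong (suc n) f≗g = cong₂ _+_ (f≗g zero) (∑-cong n (f≗g ∘ suc))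

∑-swap : ∀ m n (f : Fin m → Fin n → ℤ) →
         ∑ m (λ i → ∑ n (f i)) ≡ ∑ n (λ j → ∑ m (λ i → f i j))
∑-swap m n f = begin
  ∑ m (λ i → ∑ n (f i))           ≡⟨ ∑∑≡sum-sum m n f ⟩
  sum (λ i → sum (f i))           ≡⟨ ∑-comm f ⟩
  sum (λ j → sum (λ i → f i j))   ≡⟨ ∑∑≡sum-sum n m (λ j i → f i j) ⟨
  ∑ n (λ j → ∑ m (λ i → f i j))   ∎
  where
  open ≡-Reasoning
  ∑∑≡sum-sum : ∀ m n (g : Fin m → Fin n → ℤ) → ∑ m (λ i → ∑ n (g i)) ≡ sum (λ i → sum (g i))
  ∑∑≡sum-sum m n g = trans (∑≡sum m _) (sum-cong-≗ (λ i → ∑≡sum n (g i)))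

*-distribˡ-∑ : ∀ n c (f : Fin n → ℤ) → c ℤ.* ∑ n f ≡ ∑ n (λ i → c ℤ.* f i)
*-distribˡ-∑ zero    c f = ℤ.*-zeroʳ c
*-distribˡ-∑ (suc n) c f =
  trans (ℤ.*-distribˡ-+ c (f zero) _) (cong (_+_ (c ℤ.* f zero)) (*-distribˡ-∑ n c (f ∘ suc)))

*-distribʳ-∑ : ∀ n c (f : Fin n → ℤ) → ∑ n f ℤ.* c ≡ ∑ n (λ i → f i ℤ.* c)
*-distribʳ-∑ zero    c f = refl
*-distribʳ-∑ (suc n) c f =
  trans (ℤ.*-distribʳ-+ c (f zero) _) (cong (_+_ (f zero ℤ.* c)) (*-distribʳ-∑ n c (f ∘ suc)))

neg-distrib-∑ : ∀ n (f : Fin n → ℤ) → - ∑ n f ≡ ∑ n (λ i → - f i)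
neg-distrib-∑ zero    f = refl
neg-distrib-∑ (suc n) f =
  trans (ℤ.neg-distrib-+ (f zero) _) (cong (_+_ (- f zero)) (neg-distrib-∑ n (f ∘ suc)))

∑-const : ∀ n c → ∑ n (λ _ → + c) ≡ + (n * c)
∑-const zero    c = refl
∑-const (suc n) c = cong (_+_ (+ c)) (∑-const n c)

∑-mono-≤ : ∀ n {f g : Fin n → ℤ} → (∀ i → f i ℤ.≤ g i) → ∑ n f ℤ.≤ ∑ n g
∑-mono-≤ zero    f≤g = ℤ.≤-refl
∑-mono-≤ (suc n) f≤g = ℤ.+-mono-≤ (f≤g zero) (∑-mono-≤ n (f≤g ∘ suc))

∑-mono-< : ∀ n {f g : Fin n → ℤ} → (∀ i → f i ℤ.≤ g i) → ∀ r → f r < g r → ∑ n f < ∑ n g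
∑-mono-< (suc n) f≤g zero    fr<gr = ℤ.+-mono-<-≤ fr<gr (∑-mono-≤ n (f≤g ∘ suc))
∑-mono-< (suc n) f≤g (suc r) fr<gr = ℤ.+-mono-≤-< (f≤g zero) (∑-mono-< n (f≤g ∘ suc) r fr<gr)

∑-nonneg : ∀ n {f : Fin n → ℤ} → (∀ i → + 0 ℤ.≤ f i) → + 0 ℤ.≤ ∑ n f
∑-nonneg zero    f≥0 = ℤ.≤-refl
∑-nonneg (suc n) f≥0 = ℤ.+-mono-≤ (f≥0 zero) (∑-nonneg n (f≥0 ∘ suc))

≤-∑ : ∀ n {f : Fin n → ℤ} → (∀ i → + 0 ℤ.≤ f i) → ∀ i → f i ℤ.≤ ∑ n f
≤-∑ (suc n) {f} f≥0 zero =
  ℤ.i≤i+j (f zero) (∑ n (f ∘ suc)) {{ℤ.nonNegative (∑-nonneg n (f≥0 ∘ suc))}}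
≤-∑ (suc n) {f} f≥0 (suc i) =
  ℤ.≤-trans (≤-∑ n (f≥0 ∘ suc) i) (ℤ.i≤j+i (∑ n (f ∘ suc)) (f zero) {{ℤ.nonNegative (f≥0 zero)}})

∑≡0⇒≡0 : ∀ n {f : Fin n → ℤ} → (∀ i → + 0 ℤ.≤ f i) → ∑ n f ≡ + 0 → ∀ i → f i ≡ + 0
∑≡0⇒≡0 n f≥0 ∑≡0 i = ℤ.≤-antisym (subst (_ ℤ.≤_) ∑≡0 (≤-∑ n f≥0 i)) (f≥0 i)

∑-B≡count : ∀ n (p : Fin n → Bool) → ∑ n (B ∘ p) ≡ + count n p
∑-B≡count zero    p = refl
∑-B≡count (suc n) p with p zero
... | true  = cong (_+_ (+ 1)) (∑-B≡count n (p ∘ suc))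
... | false = trans (ℤ.+-identityˡ _) (∑-B≡count n (p ∘ suc))

count-inject₁-≤ : ∀ n (p : Fin (suc n) → Bool) → count n (p ∘ inject₁) ≤ count (suc n) p
count-inject₁-≤ zero    p = z≤n
count-inject₁-≤ (suc n) p = ℕ.+-monoʳ-≤ _ (count-inject₁-≤ n (p ∘ suc))

sq-nonneg : ∀ a → + 0 ℤ.≤ sq a
sq-nonneg (+ zero)   = +≤+ z≤n
sq-nonneg (+ suc n)  = +≤+ z≤n
sq-nonneg ℤ.-[1+ n ] = +≤+ z≤n

sq≡0⇒≡0 : ∀ a → sq a ≡ + 0 → a ≡ + 0
sq≡0⇒≡0 (+ zero)   _  = refl
sq≡0⇒≡0 (+ suc n)  ()
sq≡0⇒≡0 ℤ.-[1+ n ] ()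

∑-sq≡0⇒≡0 : ∀ n (f : Fin n → ℤ) → ∑ n (sq ∘ f) ≡ + 0 → ∀ j → f j ≡ + 0
∑-sq≡0⇒≡0 n f ∑≡0 j = sq≡0⇒≡0 (f j) (∑≡0⇒≡0 n (sq-nonneg ∘ f) ∑≡0 j)

[]-≤ : ∀ b {t} → + 0 ℤ.≤ t → [ b ] t ℤ.≤ t
[]-≤ true  t≥0 = ℤ.≤-refl
[]-≤ false t≥0 = t≥0

[]-nonneg : ∀ b {t} → + 0 ℤ.≤ t → + 0 ℤ.≤ [ b ] t
[]-nonneg true  t≥0 = t≥0
[]-nonneg false t≥0 = ℤ.≤-refl

B*B*B-nonneg : ∀ a b c → + 0 ℤ.≤ B a ℤ.* B b ℤ.* B c
B*B*B-nonneg true  true  true  = +≤+ z≤n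
B*B*B-nonneg true  true  false = +≤+ z≤n
B*B*B-nonneg true  false c     = +≤+ z≤n
B*B*B-nonneg false b     c     = +≤+ z≤n

B*≤1*≤1≤B : ∀ b {c d} → c ≤ 1 → d ≤ 1 → B b ℤ.* + c ℤ.* + d ℤ.≤ B b
B*≤1*≤1≤B true  z≤n       _         = +≤+ z≤n
B*≤1*≤1≤B true  (s≤s z≤n) z≤n       = +≤+ z≤n
B*≤1*≤1≤B true  (s≤s z≤n) (s≤s z≤n) = ℤ.≤-refl
B*≤1*≤1≤B false _         _         = ℤ.≤-refl

neg≤[]B*[1-] : ∀ b f {A} → + 0 ℤ.≤ A → - A ℤ.≤ [ b ] (B f ℤ.* (+ 1 - A))
neg≤[]B*[1-] false f     A≥0 = ℤ.neg-mono-≤ A≥0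
neg≤[]B*[1-] true  false A≥0 = ℤ.neg-mono-≤ A≥0
neg≤[]B*[1-] true  true  {A} A≥0 =
  subst (- A ℤ.≤_) (sym (ℤ.*-identityˡ (+ 1 - A))) (ℤ.i≤j+i (- A) (+ 1))

edgeCount : ∀ {n} → (Fin n → Fin n → Bool) → ℤ
edgeCount {n} G = ∑ n λ j → ∑ n λ k → B (G j k)

edgesBetween : ∀ {n} (e G : Fin n → Fin n → Bool) (a b : Fin n → Bool) → ℤ
edgesBetween {n} e G a b = ∑ n λ j → ∑ n λ k → [ e j k ] (B (G j k) ℤ.* B (a j) ℤ.* B (b k))

edgesBetween-nonneg : ∀ {n} (e G : Fin n → Fin n → Bool) a b → + 0 ℤ.≤ edgesBetween e G a b
edgesBetween-nonneg {n} e G a b =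
  ∑-nonneg n λ j → ∑-nonneg n λ k → []-nonneg (e j k) (B*B*B-nonneg (G j k) (a j) (b k))

∑∑∑∑-bilinear : ∀ m n (c : Fin n → Fin n → ℤ) (a : Fin m → Fin n → ℤ) →
  ∑ m (λ i → ∑ m λ l → ∑ n λ j → ∑ n λ k → c j k ℤ.* a i j ℤ.* a l k)
  ≡ ∑ n (λ j → ∑ n λ k → c j k ℤ.* ∑ m (λ i → a i j) ℤ.* ∑ m (λ l → a l k))
∑∑∑∑-bilinear m n c a = begin
  ∑ m (λ i → ∑ m λ l → ∑ n λ j → ∑ n λ k → c j k ℤ.* a i j ℤ.* a l k)
    ≡⟨ ∑-cong m (λ i → ∑-swap m n _) ⟩
  ∑ m (λ i → ∑ n λ j → ∑ m λ l → ∑ n λ k → c j k ℤ.* a i j ℤ.* a l k)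
    ≡⟨ ∑-swap m n _ ⟩
  ∑ n (λ j → ∑ m λ i → ∑ m λ l → ∑ n λ k → c j k ℤ.* a i j ℤ.* a l k)
    ≡⟨ ∑-cong n (λ j → ∑-cong m λ i → ∑-swap m n _) ⟩
  ∑ n (λ j → ∑ m λ i → ∑ n λ k → ∑ m λ l → c j k ℤ.* a i j ℤ.* a l k)
    ≡⟨ ∑-cong n (λ j → ∑-swap m n _) ⟩
  ∑ n (λ j → ∑ n λ k → ∑ m λ i → ∑ m λ l → c j k ℤ.* a i j ℤ.* a l k)
    ≡⟨ ∑-cong n (λ j → ∑-cong n λ k → factor j k) ⟩
  ∑ n (λ j → ∑ n λ k → c j k ℤ.* ∑ m (λ i → a i j) ℤ.* ∑ m (λ l → a l k)) ∎
  where
  open ≡-Reasoning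
  factor : ∀ j k → ∑ m (λ i → ∑ m λ l → c j k ℤ.* a i j ℤ.* a l k)
                 ≡ c j k ℤ.* ∑ m (λ i → a i j) ℤ.* ∑ m (λ l → a l k)
  factor j k = begin
    ∑ m (λ i → ∑ m λ l → c j k ℤ.* a i j ℤ.* a l k)
      ≡⟨ ∑-cong m (λ i → *-distribˡ-∑ m (c j k ℤ.* a i j) (λ l → a l k)) ⟨
    ∑ m (λ i → c j k ℤ.* a i j ℤ.* ∑ m (λ l → a l k))
      ≡⟨ *-distribʳ-∑ m _ (λ i → c j k ℤ.* a i j) ⟨
    ∑ m (λ i → c j k ℤ.* a i j) ℤ.* ∑ m (λ l → a l k)
      ≡⟨ cong (ℤ._* ∑ m (λ l → a l k)) (*-distribˡ-∑ m (c j k) (λ i → a i j)) ⟨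
    c j k ℤ.* ∑ m (λ i → a i j) ℤ.* ∑ m (λ l → a l k) ∎

∑∑-edgesBetween≤edgeCount : ∀ m n (e G : Fin n → Fin n → Bool) (X : Fin m → Fin n → Bool) →
  (∀ j → count m (λ i → X i j) ≤ 1) →
  ∑ m (λ i → ∑ m λ l → edgesBetween e G (X i) (X l)) ℤ.≤ edgeCount G
∑∑-edgesBetween≤edgeCount m n e G X atMostOne = begin
  ∑ m (λ i → ∑ m λ l → edgesBetween e G (X i) (X l))
    ≤⟨ ∑-mono-≤ m (λ i → ∑-mono-≤ m λ l → ∑-mono-≤ n λ j → ∑-mono-≤ n λ k →
         []-≤ (e j k) (B*B*B-nonneg (G j k) (X i j) (X l k))) ⟩
  ∑ m (λ i → ∑ m λ l → ∑ n λ j → ∑ n λ k → B (G j k) ℤ.* B (X i j) ℤ.* B (X l k))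
    ≡⟨ ∑∑∑∑-bilinear m n (λ j k → B (G j k)) (λ i j → B (X i j)) ⟩
  ∑ n (λ j → ∑ n λ k → B (G j k) ℤ.* ∑ m (λ i → B (X i j)) ℤ.* ∑ m (λ l → B (X l k)))
    ≡⟨ ∑-cong n (λ j → ∑-cong n λ k →
         cong₂ (λ s t → B (G j k) ℤ.* s ℤ.* t) (∑-B≡count m (λ i → X i j)) (∑-B≡count m (λ l → X l k))) ⟩
  ∑ n (λ j → ∑ n λ k → B (G j k) ℤ.* + count m (λ i → X i j) ℤ.* + count m (λ l → X l k))
    ≤⟨ ∑-mono-≤ n (λ j → ∑-mono-≤ n λ k → B*≤1*≤1≤B (G j k) (atMostOne j) (atMostOne k)) ⟩
  edgeCount G ∎
  where open ℤ.≤-Reasoning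

neg-∑∑≤∑∑[]B*[1-] : ∀ m (d F : Fin m → Fin m → Bool) (A : Fin m → Fin m → ℤ) →
  (∀ i l → + 0 ℤ.≤ A i l) →
  - ∑ m (λ i → ∑ m (A i)) ℤ.≤ ∑ m (λ i → ∑ m λ l → [ d i l ] (B (F i l) ℤ.* (+ 1 - A i l)))
neg-∑∑≤∑∑[]B*[1-] m d F A A≥0 = begin
  - ∑ m (λ i → ∑ m (A i))        ≡⟨ neg-distrib-∑ m _ ⟩
  ∑ m (λ i → - ∑ m (A i))        ≡⟨ ∑-cong m (λ i → neg-distrib-∑ m (A i)) ⟩
  ∑ m (λ i → ∑ m λ l → - A i l)
    ≤⟨ ∑-mono-≤ m (λ i → ∑-mono-≤ m λ l → neg≤[]B*[1-] (d i l) (F i l) (A≥0 i l)) ⟩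
  ∑ m (λ i → ∑ m λ l → [ d i l ] (B (F i l) ℤ.* (+ 1 - A i l))) ∎
  where open ℤ.≤-Reasoning

indeg≤2 : ∀ {k n} (N : Network k n) v → indeg (Network.g N) v ≤ 2
indeg≤2 N v with Network.degrees N v
... | inj₁ refl                      = subst (_≤ 2) (sym (Network.root-indeg N)) z≤n
... | inj₂ (inj₁ (d≡1 , _))          = subst (_≤ 2) (sym d≡1) (s≤s z≤n)
... | inj₂ (inj₂ (inj₁ (d≡1 , _)))   = subst (_≤ 2) (sym d≡1) (s≤s z≤n)
... | inj₂ (inj₂ (inj₂ (d≡2 , _)))   = subst (_≤ 2) (sym d≡2) ℕ.≤-refl

edgeCount<2n : ∀ {k n} (N : Network k n) → edgeCount (Network.g N) < + (2 * n)
edgeCount<2n {n = n} N = begin-strict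
  edgeCount g                    ≡⟨ ∑-swap n n _ ⟩
  ∑ n (λ k → ∑ n λ j → B (g j k)) ≡⟨ ∑-cong n (λ k → ∑-B≡count n (λ j → g j k)) ⟩
  ∑ n (λ k → + indeg g k)         <⟨ ∑-mono-< n (λ k → +≤+ (indeg≤2 N k)) root root-indeg<2 ⟩
  ∑ n (λ _ → + 2)                 ≡⟨ ∑-const n 2 ⟩
  + (n * 2)                       ≡⟨ cong +_ (ℕ.*-comm n 2) ⟩
  + (2 * n)                       ∎
  where
  open Network N using (g; root; root-indeg)
  open ℤ.≤-Reasoning
  root-indeg<2 : + indeg g root < + 2
  root-indeg<2 = subst (λ d → + d < + 2) (sym root-indeg) (ℤ.+<+ (s≤s z≤n))

P₂≡0⇒column-count≡1 : ∀ {k nN nT} (N : Network k nN) (T : PhyloTree k nT) ℓ (V : Vars nN nT) →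
  P₂ N T ℓ V ≡ + 0 → ∀ j → count (suc nT) (λ i → Vars.x V i j) ≡ 1
P₂≡0⇒column-count≡1 {nN = nN} {nT} N T ℓ V P₂≡0 j = ℤ.+-injective (begin
  + count (suc nT) (λ i → x i j)   ≡⟨ ∑-B≡count (suc nT) (λ i → x i j) ⟨
  ∑ (suc nT) (λ i → B (x i j))    ≡⟨ ℤ.i-j≡0⇒i≡j _ (+ 1) (∑-sq≡0⇒≡0 nN column-excess P₂≡0 j) ⟩
  + 1                             ∎)
  where
  open ≡-Reasoning
  x = Vars.x V
  column-excess : Fin nN → ℤ
  column-excess j = ∑ (suc nT) (λ i → B (x i j)) - + 1

lemma16 : ∀ {k nN nT} (N : Network k nN) (T : PhyloTree k nT) → nT ≤ nN →
            (ℓ : Fin nT → Fin nN) →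
            (∀ a → ℓ (PhyloTree.label T a) ≡ Network.label N a) →
            (V : Vars nN nT) →
            P₁ N T ℓ V ≡ + 0 → P₂ N T ℓ V ≡ + 0 → P₃ N T ℓ V ≡ + 0 →
            P₄ N T ℓ V ≡ + 0 → P₅ N T ℓ V ≡ + 0 → P₆ N T ℓ V ≡ + 0 →
            P₇ N T ℓ V ≡ + 0 → P₈ N T ℓ V ≡ + 0 → P₉ N T ℓ V ≡ + 0 →
            P₁₀ N T ℓ V ≡ + 0 →
            - (+ (2 * nN)) < P₁₂ N T ℓ V
lemma16 {nN = nN} {nT} N T _ ℓ _ V _ P₂≡0 _ _ _ _ _ _ _ _ = begin-strict
  - (+ (2 * nN))                          <⟨ ℤ.neg-mono-< (edgeCount<2n N) ⟩
  - edgeCount (Network.g N)               ≤⟨ ℤ.neg-mono-≤ (∑∑-edgesBetween≤edgeCount nT nN ne (Network.g N) X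
                                                            column-count≤1) ⟩
  - ∑ nT (λ i → ∑ nT λ l → A i l)         ≤⟨ neg-∑∑≤∑∑[]B*[1-] nT ne (PhyloTree.g T) A
                                                (λ i l → edgesBetween-nonneg ne (Network.g N) (X i) (X l)) ⟩
  P₁₂ N T ℓ V                              ∎
  where
  open ℤ.≤-Reasoning
  ne : ∀ {n} → Fin n → Fin n → Bool
  ne i l = not ⌊ i ≟ l ⌋
  X : Fin nT → Fin nN → Bool
  X i = Vars.x V (inject₁ i)
  A : Fin nT → Fin nT → ℤ
  A i l = edgesBetween ne (Network.g N) (X i) (X l)
  column-count≤1 : ∀ j → count nT (λ i → X i j) ≤ 1
  column-count≤1 j = subst (count nT (λ i → X i j) ≤_) (P₂≡0⇒column-count≡1 N T ℓ V P₂≡0 j)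
                           (count-inject₁-≤ nT (λ i → Vars.x V i j))
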